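{- Let $\equiv$ be a non-confusing congruence on types. If $\Gamma\vdash t:A$ and $t_\Gamma\longrightarrow u_\Gamma$ (one step top-level $\beta$-reduction), then $\Gamma\vdash u:A$.
   Context: Fix a many-sorted first-order language; terms $a::=x\mid f(a_1,\ldots,a_n)$; types $A::=P(a_1,\ldots,a_n)\mid A\Rightarrow A'\mid\forall x\,A$ with usual capture-avoiding substitution $[a/x]$. A context is a finite SET of types. $\equiv$ is a congruence on types which is non-confusing: if $A\equiv B$ then at least one is atomic, or both are implications, or both are universal quantifications; $(A\Rightarrow A')\equiv(B\Rightarrow B')$ implies $A\equiv B$, $A'\equiv B'$; $(\forall x\,A)\equiv(\forall x\,B)$ implies $A\equiv B$. Schemes: $t::=\mathbf{v}_A\mid\lambda_At\mid(t\ t')\mid\Lambda x\,t\mid(t\ a)$, $\mathbf{v}_A$ the canonical variable of type $A$. Typing: $\Gamma\vdash\mathbf{v}_A:A$ if $A\in\Gamma$; from $\Gamma\cup\{A\}\vdash t:B$ infer $\Gamma\vdash\lambda_At:A\Rightarrow B$; from $\Gamma\vdash t:A\Rightarrow B$, $\Gamma\vdash u:A$ infer $\Gamma\vdash(t\ u):B$; from $\Gamma\vdash t:A$ infer $\Gamma\vdash\Lambda x\,t:\forall x\,A$ if $x$ not free in $\Gamma$; from $\Gamma\vdash t:\forall x\,A$ infer $\Gamma\vdash(t\ a):[a/x]A$; from $\Gamma\vdash t:A$ and $A\equiv B$ infer $\Gamma\vdash t:B$. A scheme in context $t_\Gamma$ is a pair with $t$ well-typed in $\Gamma$. Term substitution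 $[a/x]t$ on schemes is capture-avoiding ($[a/x]\mathbf{v}_A=\mathbf{v}_{[a/x]A}$, $[a/x]\lambda_At=\lambda_{[a/x]A}[a/x]t$, bound term variables renamed). Scheme substitution: for a finite map $\sigma$ from types to schemes and context $\Gamma$, the set $\sigma_\Gamma t$: $\sigma_\Gamma\mathbf{v}_A=\{\mathbf{v}_A,\sigma(A)\}$ if $A\in dom(\sigma)$, $A\in\Gamma$; $=\{\sigma(A)\}$ if $A\in dom(\sigma)$, $A\notin\Gamma$; $=\{\mathbf{v}_A\}$ if $A\notin dom(\sigma)$; $\sigma_\Gamma(\lambda_At)=\{\lambda_At':t'\in\sigma_{\Gamma\cup\{A\}}t\}$; $\sigma_\Gamma(u\ v)=\{(u'\ v'):u'\in\sigma_\Gamma u,v'\in\sigma_\Gamma v\}$; $\sigma_\Gamma(\Lambda x\,t)=\{\Lambda x'\,t':t'\in\sigma_\Gamma([x'/x]t)\}$, $x'$ fresh; $\sigma_\Gamma(t\ a)=\{(t'\ a):t'\in\sigma_\Gamma t\}$. One step top-level $\beta$-reduction: $((\lambda_At)\ u)_\Gamma\longrightarrow v_\Gamma$ for every $v\in[u/A]_\Gamma t$, and $((\Lambda x\,t)\ a)_\Gamma\longrightarrow([a/x]t)_\Gamma$. -}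

module Defs where

open import Data.Nat using (ℕ; zero; suc; _<_)
import Data.Nat as ℕ
open import Data.List using (List; []; _∷_)
open import Data.List.Membership.Propositional using (_∈_)
open import Data.List.Relation.Unary.Any using (Any)
open import Data.List.Relation.Unary.All using (All)
open import Data.Product using (Σ; _×_; _,_; proj₁)
open import Data.Product.Properties using (≡-dec)
open import Data.Sum using (_⊎_)
open import Data.Empty using (⊥)
open import Data.Unit using (⊤)
open import Relation.Nullary using (¬_; yes; no)
open import Relation.Binary.Definitions using (DecidableEquality)
open import Relation.Binary.PropositionalEquality using (_≡_; _≢_)

-- A many-sorted first-order signature.  Variables of sort s are the
-- pairs (s , n), n : ℕ, so every sort has infinitely many variables.

record Signature : Set₁ where
  field
    Sort    : Set
    _≟S_    : DecidableEquality Sort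
    FunSym  : Set
    funDom  : FunSym → List Sort
    funCod  : FunSym → Sort
    PredSym : Set
    predDom : PredSym → List Sort

module _ (Sg : Signature) where
  open Signature Sg

  Var : Set
  Var = Sort × ℕ

  _≟V_ : DecidableEquality Var
  _≟V_ = ≡-dec _≟S_ ℕ._≟_

  -- Syntax, locally nameless: bound term variables are de Bruijn
  -- indices (so α-equivalent objects are syntactically equal), free
  -- term variables are named.

  data Tm : Set where
    fvar : Var → Tm
    bvar : ℕ → Tm
    fun  : FunSym → List Tm → Tm

  -- types  A ::= P(a1,...,an) | A ⇒ A' | ∀x A   (all s A binds index 0,
  -- the bound variable having sort s)
  data Ty : Set where
    atom : PredSym → List Tm → Ty
    _⇒_  : Ty → Ty → Ty
    all  : Sort → Ty → Ty

  infixr 5 _⇒_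

  data Sch : Set where
    v    : Ty → Sch
    lam  : Ty → Sch → Sch
    _·_  : Sch → Sch → Sch
    Lam  : Sort → Sch → Sch       -- binds index 0 (of the given sort)
    _·ₜ_ : Sch → Tm → Sch

  -- contexts: finite sets of types, represented by lists up to membership
  Ctx : Set
  Ctx = List Ty

  mutual
    openTm : ℕ → Tm → Tm → Tm
    openTm k a (fvar x) = fvar x
    openTm k a (bvar i) with i ℕ.≟ k
    ... | yes _ = a
    ... | no _  = bvar i
    openTm k a (fun f as) = fun f (openTms k a as)

    openTms : ℕ → Tm → List Tm → List Tm
    openTms k a []       = []
    openTms k a (b ∷ bs) = openTm k a b ∷ openTms k a bs

  mutual
    closeTm : ℕ → Var → Tm → Tm
    closeTm k x (fvar y) with x ≟V y
    ... | yes _ = bvar k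
    ... | no _  = fvar y
    closeTm k x (bvar i) = bvar i
    closeTm k x (fun f as) = fun f (closeTms k x as)

    closeTms : ℕ → Var → List Tm → List Tm
    closeTms k x []       = []
    closeTms k x (b ∷ bs) = closeTm k x b ∷ closeTms k x bs

  mutual
    substTm : Var → Tm → Tm → Tm
    substTm x a (fvar y) with y ≟V x
    ... | yes _ = a
    ... | no _  = fvar y
    substTm x a (bvar i) = bvar i
    substTm x a (fun f as) = fun f (substTms x a as)

    substTms : Var → Tm → List Tm → List Tm
    substTms x a []       = []
    substTms x a (b ∷ bs) = substTm x a b ∷ substTms x a bs

  openTy : ℕ → Tm → Ty → Ty
  openTy k a (atom P as) = atom P (openTms k a as)
  openTy k a (A ⇒ B)     = openTy k a A ⇒ openTy k a B
  openTy k a (all s A)   = all s (openTy (suc k) a A)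

  closeTy : ℕ → Var → Ty → Ty
  closeTy k x (atom P as) = atom P (closeTms k x as)
  closeTy k x (A ⇒ B)     = closeTy k x A ⇒ closeTy k x B
  closeTy k x (all s A)   = all s (closeTy (suc k) x A)

  -- [a/x]A  (capture-free since a is locally closed when it matters)
  substTy : Var → Tm → Ty → Ty
  substTy x a (atom P as) = atom P (substTms x a as)
  substTy x a (A ⇒ B)     = substTy x a A ⇒ substTy x a B
  substTy x a (all s A)   = all s (substTy x a A)

  openS : ℕ → Tm → Sch → Sch
  openS k a (v A)     = v (openTy k a A)
  openS k a (lam A t) = lam (openTy k a A) (openS k a t)
  openS k a (t · u)   = openS k a t · openS k a u
  openS k a (Lam s t) = Lam s (openS (suc k) a t)
  openS k a (t ·ₜ b)  = openS k a t ·ₜ openTm k a b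

  closeS : ℕ → Var → Sch → Sch
  closeS k x (v A)     = v (closeTy k x A)
  closeS k x (lam A t) = lam (closeTy k x A) (closeS k x t)
  closeS k x (t · u)   = closeS k x t · closeS k x u
  closeS k x (Lam s t) = Lam s (closeS (suc k) x t)
  closeS k x (t ·ₜ b)  = closeS k x t ·ₜ closeTm k x b

  mutual
    FvTm : Var → Tm → Set
    FvTm x (fvar y)   = y ≡ x
    FvTm x (bvar i)   = ⊥
    FvTm x (fun f as) = FvTms x as

    FvTms : Var → List Tm → Set
    FvTms x []       = ⊥
    FvTms x (b ∷ bs) = FvTm x b ⊎ FvTms x bs

  FvTy : Var → Ty → Set
  FvTy x (atom P as) = FvTms x as
  FvTy x (A ⇒ B)     = FvTy x A ⊎ FvTy x B
  FvTy x (all s A)   = FvTy x A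

  FvS : Var → Sch → Set
  FvS x (v A)     = FvTy x A
  FvS x (lam A t) = FvTy x A ⊎ FvS x t
  FvS x (t · u)   = FvS x t ⊎ FvS x u
  FvS x (Lam s t) = FvS x t
  FvS x (t ·ₜ a)  = FvS x t ⊎ FvTm x a

  FvCtx : Var → Ctx → Set
  FvCtx x Γ = Any (FvTy x) Γ

  -- local closure (the objects of the paper are the locally closed ones)

  mutual
    LcTm : ℕ → Tm → Set
    LcTm k (fvar x)   = ⊤
    LcTm k (bvar i)   = i < k
    LcTm k (fun f as) = LcTms k as

    LcTms : ℕ → List Tm → Set
    LcTms k []       = ⊤
    LcTms k (b ∷ bs) = LcTm k b × LcTms k bs

  LcTy : ℕ → Ty → Set
  LcTy k (atom P as) = LcTms k as
  LcTy k (A ⇒ B)     = LcTy k A × LcTy k B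
  LcTy k (all s A)   = LcTy (suc k) A

  LcS : ℕ → Sch → Set
  LcS k (v A)     = LcTy k A
  LcS k (lam A t) = LcTy k A × LcS k t
  LcS k (t · u)   = LcS k t × LcS k u
  LcS k (Lam s t) = LcS (suc k) t
  LcS k (t ·ₜ a)  = LcS k t × LcTm k a

  LcCtx : Ctx → Set
  LcCtx Γ = All (LcTy 0) Γ

  mutual
    data HasSort : Tm → Sort → Set where
      fvar : ∀ {s n} → HasSort (fvar (s , n)) s
      fun  : ∀ {f as} → HasSorts as (funDom f) → HasSort (fun f as) (funCod f)

    data HasSorts : List Tm → List Sort → Set where
      []  : HasSorts [] []
      _∷_ : ∀ {a as s ss} → HasSort a s → HasSorts as ss → HasSorts (a ∷ as) (s ∷ ss)

  IsAtom : Ty → Set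
  IsAtom A = Σ PredSym λ P → Σ (List Tm) λ as → A ≡ atom P as

  BothImp : Ty → Ty → Set
  BothImp A B = Σ Ty λ A₁ → Σ Ty λ A₂ → Σ Ty λ B₁ → Σ Ty λ B₂ →
                A ≡ (A₁ ⇒ A₂) × B ≡ (B₁ ⇒ B₂)

  BothAll : Ty → Ty → Set
  BothAll A B = Σ Sort λ s → Σ Ty λ A₁ → Σ Ty λ B₁ →
                A ≡ all s A₁ × B ≡ all s B₁

  record NonConfusingCongruence (_≈_ : Ty → Ty → Set) : Set where
    field
      ≈-refl  : ∀ {A} → A ≈ A
      ≈-sym   : ∀ {A B} → A ≈ B → B ≈ A
      ≈-trans : ∀ {A B C} → A ≈ B → B ≈ C → A ≈ C
      ⇒-cong  : ∀ {A A′ B B′} → A ≈ A′ → B ≈ B′ → (A ⇒ B) ≈ (A′ ⇒ B′)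
      all-cong : ∀ {A B} (x : Var) → A ≈ B →
                 all (proj₁ x) (closeTy 0 x A) ≈ all (proj₁ x) (closeTy 0 x B)
      subst-stable : ∀ {A B} (x : Var) (a : Tm) → HasSort a (proj₁ x) →
                     A ≈ B → substTy x a A ≈ substTy x a B
      shape   : ∀ {A B} → A ≈ B → IsAtom A ⊎ IsAtom B ⊎ BothImp A B ⊎ BothAll A B
      ⇒-inj   : ∀ {A A′ B B′} → (A ⇒ A′) ≈ (B ⇒ B′) → A ≈ B × A′ ≈ B′
      all-inj : ∀ {s A B} → all s A ≈ all s B →
                (n : ℕ) → ¬ FvTy (s , n) A → ¬ FvTy (s , n) B →
                openTy 0 (fvar (s , n)) A ≈ openTy 0 (fvar (s , n)) B

  module _ (_≈_ : Ty → Ty → Set) where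
    data Typed (Γ : Ctx) : Sch → Ty → Set where
      ax   : ∀ {A} → A ∈ Γ → Typed Γ (v A) A
      ⇒i   : ∀ {A B t} → Typed (A ∷ Γ) t B → Typed Γ (lam A t) (A ⇒ B)
      ⇒e   : ∀ {A B t u} → Typed Γ t (A ⇒ B) → Typed Γ u A → Typed Γ (t · u) B
      -- Λx t' : ∀x A' with x not free in Γ; here t' = openS 0 x t,
      -- A' = openTy 0 x A for a variable x not free in t, A.
      ∀i   : ∀ {s t A} (n : ℕ) → ¬ FvCtx (s , n) Γ → ¬ FvS (s , n) t → ¬ FvTy (s , n) A →
             Typed Γ (openS 0 (fvar (s , n)) t) (openTy 0 (fvar (s , n)) A) →
             Typed Γ (Lam s t) (all s A)
      ∀e   : ∀ {s t A a} → Typed Γ t (all s A) → HasSort a s →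
             Typed Γ (t ·ₜ a) (openTy 0 a A)
      conv : ∀ {t A B} → Typed Γ t A → A ≈ B → Typed Γ t B

  -- scheme substitution:  SubstS A u Γ t t'  means  t' ∈ [u/A]_Γ t

  data SubstS (A : Ty) (u : Sch) : Ctx → Sch → Sch → Set where
    v-rep   : ∀ {Γ} → SubstS A u Γ (v A) u
    v-keep  : ∀ {Γ} → A ∈ Γ → SubstS A u Γ (v A) (v A)
    v-other : ∀ {Γ B} → B ≢ A → SubstS A u Γ (v B) (v B)
    lam     : ∀ {Γ C t t′} → SubstS A u (C ∷ Γ) t t′ → SubstS A u Γ (lam C t) (lam C t′)
    app     : ∀ {Γ t t′ w w′} → SubstS A u Γ t t′ → SubstS A u Γ w w′ →
              SubstS A u Γ (t · w) (t′ · w′)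
    -- Λx t ↦ Λx' t' with t' ∈ σ_Γ([x'/x]t), x' fresh
    Lam     : ∀ {Γ s t t′} (n : ℕ) →
              ¬ FvS (s , n) t → ¬ FvTy (s , n) A → ¬ FvS (s , n) u → ¬ FvCtx (s , n) Γ →
              SubstS A u Γ (openS 0 (fvar (s , n)) t) t′ →
              SubstS A u Γ (Lam s t) (Lam s (closeS 0 (s , n) t′))
    inst    : ∀ {Γ t t′ a} → SubstS A u Γ t t′ → SubstS A u Γ (t ·ₜ a) (t′ ·ₜ a)

  data Step (Γ : Ctx) : Sch → Sch → Set where
    β-λ : ∀ {A t u w} → SubstS A u Γ t w → Step Γ (lam A t · u) w
    β-Λ : ∀ {s t a} → Step Γ (Lam s t ·ₜ a) (openS 0 a t)

{-# OPTIONS --safe #-}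
-- For ((Λx t) a): the premise of ∀i, typed at one eigenvariable, can be instantiated at any
-- well-sorted term, since typing is stable under substituting terms for term variables (≡ being
-- stable as well); non-confusion makes the two quantified sorts agree and turns ∀x E′ ≡ ∀x E
-- into [a/x]E′ ≡ [a/x]E. For ((λ_A t) u): non-confusion splits the ⇒-type of λ_A t, so t is
-- typed in Γ ∪ {A} and u at A; by induction on the scheme substitution every element of
-- [u/A]_Γ t keeps the type of t, since each v_A is either replaced by u or kept with A ∈ Γ.
module Submission where

open import Data.Nat using (ℕ; suc; _<_; _≤_; _⊔_; s≤s)
import Data.Nat as ℕ
open import Data.Nat.Properties
  using (<⇒≢; <⇒≱; ≤∧≢⇒<; m<n⇒m<1+n; n<1+n; ≤-refl; m≤n⇒m≤n⊔o; m≤n⇒m≤o⊔n; m⊔n<o⇒m<o; m⊔n<o⇒n<o)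
open import Data.List using (List; []; _∷_)
open import Data.List.Membership.Propositional using (_∈_; lose)
open import Data.List.Relation.Binary.Subset.Propositional using (_⊆_)
open import Data.List.Relation.Binary.Subset.Propositional.Properties using (xs⊆x∷xs)
open import Data.List.Relation.Unary.Any using (here; there)
open import Data.List.Relation.Unary.All using (All; []; _∷_)
open import Data.Product using (Σ; _×_; _,_; proj₁; proj₂)
open import Data.Sum using (inj₁; inj₂)
open import Data.Empty using (⊥-elim)
open import Function using (_∘_)
open import Data.Unit using (tt)
open import Relation.Nullary using (¬_; yes; no)
open import Relation.Binary.Definitions using (DecidableEquality)
open import Relation.Binary.PropositionalEquality
  using (_≡_; _≢_; refl; sym; trans; cong; cong₂; subst; subst₂; module ≡-Reasoning)
import Defs as D
open D using ( Signature; fvar; bvar; fun; atom; _⇒_; all; v; lam; _·_; Lam; _·ₜ_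
             ; NonConfusingCongruence; ax; ⇒i; ⇒e; ∀i; ∀e; conv
             ; v-rep; v-keep; v-other; app; inst; β-λ; β-Λ)

module Metatheory (Sg : Signature) where
  open Signature Sg using (Sort)

  Var : Set
  Var = D.Var Sg

  _≟V_ : DecidableEquality Var
  _≟V_ = D._≟V_ Sg

  Tm : Set
  Tm = D.Tm Sg

  Ty : Set
  Ty = D.Ty Sg

  Sch : Set
  Sch = D.Sch Sg

  Ctx : Set
  Ctx = D.Ctx Sg

  openTm : ℕ → Tm → Tm → Tm
  openTm = D.openTm Sg

  openTms : ℕ → Tm → List Tm → List Tm
  openTms = D.openTms Sg

  openTy : ℕ → Tm → Ty → Ty
  openTy = D.openTy Sg

  openS : ℕ → Tm → Sch → Sch
  openS = D.openS Sg

  closeTm : ℕ → Var → Tm → Tm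
  closeTm = D.closeTm Sg

  closeTms : ℕ → Var → List Tm → List Tm
  closeTms = D.closeTms Sg

  closeTy : ℕ → Var → Ty → Ty
  closeTy = D.closeTy Sg

  closeS : ℕ → Var → Sch → Sch
  closeS = D.closeS Sg

  substTm : Var → Tm → Tm → Tm
  substTm = D.substTm Sg

  substTms : Var → Tm → List Tm → List Tm
  substTms = D.substTms Sg

  substTy : Var → Tm → Ty → Ty
  substTy = D.substTy Sg

  FvTm : Var → Tm → Set
  FvTm = D.FvTm Sg

  FvTms : Var → List Tm → Set
  FvTms = D.FvTms Sg

  FvTy : Var → Ty → Set
  FvTy = D.FvTy Sg

  FvS : Var → Sch → Set
  FvS = D.FvS Sg

  FvCtx : Var → Ctx → Set
  FvCtx = D.FvCtx Sg

  LcTm : ℕ → Tm → Set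
  LcTm = D.LcTm Sg

  LcTms : ℕ → List Tm → Set
  LcTms = D.LcTms Sg

  LcTy : ℕ → Ty → Set
  LcTy = D.LcTy Sg

  LcS : ℕ → Sch → Set
  LcS = D.LcS Sg

  HasSort : Tm → Sort → Set
  HasSort = D.HasSort Sg

  HasSorts : List Tm → List Sort → Set
  HasSorts = D.HasSorts Sg

  Closed : Tm → Set
  Closed a = ∀ {k} → LcTm k a

  substS : Var → Tm → Sch → Sch
  substS x a (v A)     = v (substTy x a A)
  substS x a (lam A t) = lam (substTy x a A) (substS x a t)
  substS x a (t · u)   = substS x a t · substS x a u
  substS x a (Lam s t) = Lam s (substS x a t)
  substS x a (t ·ₜ b)  = substS x a t ·ₜ substTm x a b

  substTm-hit : ∀ x a → substTm x a (fvar x) ≡ a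
  substTm-hit x a with x ≟V x
  ... | yes _ = refl
  ... | no x≢x = ⊥-elim (x≢x refl)

  substTm-miss : ∀ {x y} a → y ≢ x → substTm x a (fvar y) ≡ fvar y
  substTm-miss {x} {y} a y≢x with y ≟V x
  ... | yes y≡x = ⊥-elim (y≢x y≡x)
  ... | no _ = refl

  openTm-hit : ∀ k a → openTm k a (bvar k) ≡ a
  openTm-hit k a with k ℕ.≟ k
  ... | yes _ = refl
  ... | no k≢k = ⊥-elim (k≢k refl)

  openTm-miss : ∀ {k i} a → i ≢ k → openTm k a (bvar i) ≡ bvar i
  openTm-miss {k} {i} a i≢k with i ℕ.≟ k
  ... | yes i≡k = ⊥-elim (i≢k i≡k)
  ... | no _ = refl

  mutual
    openTm-lc : ∀ {k} c b → LcTm k b → openTm k c b ≡ b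
    openTm-lc c (fvar x)   _ = refl
    openTm-lc c (bvar i)   l = openTm-miss c (<⇒≢ l)
    openTm-lc c (fun f as) l = cong (fun f) (openTms-lc c as l)

    openTms-lc : ∀ {k} c bs → LcTms k bs → openTms k c bs ≡ bs
    openTms-lc c []       _        = refl
    openTms-lc c (b ∷ bs) (l , ls) = cong₂ _∷_ (openTm-lc c b l) (openTms-lc c bs ls)

  mutual
    substTm-openTm : ∀ x {a} k c b → Closed a →
                     substTm x a (openTm k c b) ≡ openTm k (substTm x a c) (substTm x a b)
    substTm-openTm x {a} k c (fvar y) lc-a with y ≟V x
    ... | yes _ = sym (openTm-lc _ a lc-a)
    ... | no _  = refl
    substTm-openTm x k c (bvar i) _ with i ℕ.≟ k
    ... | yes _ = refl
    ... | no _  = refl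
    substTm-openTm x k c (fun f as) lc-a = cong (fun f) (substTms-openTms x k c as lc-a)

    substTms-openTms : ∀ x {a} k c bs → Closed a →
                       substTms x a (openTms k c bs) ≡ openTms k (substTm x a c) (substTms x a bs)
    substTms-openTms x k c []       _    = refl
    substTms-openTms x k c (b ∷ bs) lc-a =
      cong₂ _∷_ (substTm-openTm x k c b lc-a) (substTms-openTms x k c bs lc-a)

  substTy-openTy : ∀ x {a} k c A → Closed a →
                   substTy x a (openTy k c A) ≡ openTy k (substTm x a c) (substTy x a A)
  substTy-openTy x k c (atom P as) lc-a = cong (atom P) (substTms-openTms x k c as lc-a)
  substTy-openTy x k c (A ⇒ B)     lc-a =
    cong₂ _⇒_ (substTy-openTy x k c A lc-a) (substTy-openTy x k c B lc-a)
  substTy-openTy x k c (all s A)   lc-a = cong (all s) (substTy-openTy x (suc k) c A lc-a)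

  substS-openS : ∀ x {a} k c t → Closed a →
                 substS x a (openS k c t) ≡ openS k (substTm x a c) (substS x a t)
  substS-openS x k c (v A)     lc-a = cong v (substTy-openTy x k c A lc-a)
  substS-openS x k c (lam A t) lc-a =
    cong₂ lam (substTy-openTy x k c A lc-a) (substS-openS x k c t lc-a)
  substS-openS x k c (t · u)   lc-a = cong₂ _·_ (substS-openS x k c t lc-a) (substS-openS x k c u lc-a)
  substS-openS x k c (Lam s t) lc-a = cong (Lam s) (substS-openS x (suc k) c t lc-a)
  substS-openS x k c (t ·ₜ b)  lc-a =
    cong₂ _·ₜ_ (substS-openS x k c t lc-a) (substTm-openTm x k c b lc-a)

  mutual
    substTm-fresh : ∀ x a b → ¬ FvTm x b → substTm x a b ≡ b
    substTm-fresh x a (fvar y)   x∉b = substTm-miss a x∉b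
    substTm-fresh x a (bvar i)   _   = refl
    substTm-fresh x a (fun f as) x∉b = cong (fun f) (substTms-fresh x a as x∉b)

    substTms-fresh : ∀ x a bs → ¬ FvTms x bs → substTms x a bs ≡ bs
    substTms-fresh x a []       _   = refl
    substTms-fresh x a (b ∷ bs) x∉b =
      cong₂ _∷_ (substTm-fresh x a b (x∉b ∘ inj₁)) (substTms-fresh x a bs (x∉b ∘ inj₂))

  substTy-fresh : ∀ x a A → ¬ FvTy x A → substTy x a A ≡ A
  substTy-fresh x a (atom P as) x∉A = cong (atom P) (substTms-fresh x a as x∉A)
  substTy-fresh x a (A ⇒ B)     x∉A =
    cong₂ _⇒_ (substTy-fresh x a A (x∉A ∘ inj₁)) (substTy-fresh x a B (x∉A ∘ inj₂))
  substTy-fresh x a (all s A)   x∉A = cong (all s) (substTy-fresh x a A x∉A)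

  substS-fresh : ∀ x a t → ¬ FvS x t → substS x a t ≡ t
  substS-fresh x a (v A)     x∉t = cong v (substTy-fresh x a A x∉t)
  substS-fresh x a (lam A t) x∉t =
    cong₂ lam (substTy-fresh x a A (x∉t ∘ inj₁)) (substS-fresh x a t (x∉t ∘ inj₂))
  substS-fresh x a (t · u)   x∉t =
    cong₂ _·_ (substS-fresh x a t (x∉t ∘ inj₁)) (substS-fresh x a u (x∉t ∘ inj₂))
  substS-fresh x a (Lam s t) x∉t = cong (Lam s) (substS-fresh x a t x∉t)
  substS-fresh x a (t ·ₜ b)  x∉t =
    cong₂ _·ₜ_ (substS-fresh x a t (x∉t ∘ inj₁)) (substTm-fresh x a b (x∉t ∘ inj₂))

  substTy-openTy-fresh : ∀ x {c} A → ¬ FvTy x A → Closed c →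
                         substTy x c (openTy 0 (fvar x) A) ≡ openTy 0 c A
  substTy-openTy-fresh x {c} A x∉A lc-c =
    trans (substTy-openTy x 0 (fvar x) A lc-c)
          (cong₂ (openTy 0) (substTm-hit x c) (substTy-fresh x c A x∉A))

  substS-openS-fresh : ∀ x {c} t → ¬ FvS x t → Closed c →
                       substS x c (openS 0 (fvar x) t) ≡ openS 0 c t
  substS-openS-fresh x {c} t x∉t lc-c =
    trans (substS-openS x 0 (fvar x) t lc-c)
          (cong₂ (openS 0) (substTm-hit x c) (substS-fresh x c t x∉t))

  mutual
    substTm-inverse : ∀ x y b → ¬ FvTm y b → substTm y (fvar x) (substTm x (fvar y) b) ≡ b
    substTm-inverse x y (fvar z) y∉b with z ≟V x
    ... | yes z≡x = trans (substTm-hit y (fvar x)) (cong fvar (sym z≡x))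
    ... | no _    = substTm-miss (fvar x) y∉b
    substTm-inverse x y (bvar i)   _   = refl
    substTm-inverse x y (fun f as) y∉b = cong (fun f) (substTms-inverse x y as y∉b)

    substTms-inverse : ∀ x y bs → ¬ FvTms y bs → substTms y (fvar x) (substTms x (fvar y) bs) ≡ bs
    substTms-inverse x y []       _   = refl
    substTms-inverse x y (b ∷ bs) y∉b =
      cong₂ _∷_ (substTm-inverse x y b (y∉b ∘ inj₁)) (substTms-inverse x y bs (y∉b ∘ inj₂))

  substTy-inverse : ∀ x y A → ¬ FvTy y A → substTy y (fvar x) (substTy x (fvar y) A) ≡ A
  substTy-inverse x y (atom P as) y∉A = cong (atom P) (substTms-inverse x y as y∉A)
  substTy-inverse x y (A ⇒ B)     y∉A =
    cong₂ _⇒_ (substTy-inverse x y A (y∉A ∘ inj₁)) (substTy-inverse x y B (y∉A ∘ inj₂))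
  substTy-inverse x y (all s A)   y∉A = cong (all s) (substTy-inverse x y A y∉A)

  mutual
    substTm-removes : ∀ {x y} b → y ≢ x → ¬ FvTm x (substTm x (fvar y) b)
    substTm-removes {x} (fvar z) y≢x x∈b with z ≟V x
    ... | yes _   = y≢x x∈b
    ... | no z≢x  = z≢x x∈b
    substTm-removes (fun f as) y≢x x∈b = substTms-removes as y≢x x∈b

    substTms-removes : ∀ {x y} bs → y ≢ x → ¬ FvTms x (substTms x (fvar y) bs)
    substTms-removes (b ∷ bs) y≢x (inj₁ x∈b)  = substTm-removes b y≢x x∈b
    substTms-removes (b ∷ bs) y≢x (inj₂ x∈bs) = substTms-removes bs y≢x x∈bs

  substTy-removes : ∀ {x y} A → y ≢ x → ¬ FvTy x (substTy x (fvar y) A)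
  substTy-removes (atom P as) y≢x x∈A        = substTms-removes as y≢x x∈A
  substTy-removes (A ⇒ B)     y≢x (inj₁ x∈A) = substTy-removes A y≢x x∈A
  substTy-removes (A ⇒ B)     y≢x (inj₂ x∈B) = substTy-removes B y≢x x∈B
  substTy-removes (all s A)   y≢x x∈A        = substTy-removes A y≢x x∈A

  mutual
    closeTm-fv : ∀ {y} k x b → FvTm y (closeTm k x b) → FvTm y b × y ≢ x
    closeTm-fv k x (fvar z) y∈b with x ≟V z
    ... | no x≢z = y∈b , λ y≡x → x≢z (trans (sym y≡x) (sym y∈b))
    closeTm-fv k x (fun f as) y∈b = closeTms-fv k x as y∈b

    closeTms-fv : ∀ {y} k x bs → FvTms y (closeTms k x bs) → FvTms y bs × y ≢ x
    closeTms-fv k x (b ∷ bs) (inj₁ y∈b) with closeTm-fv k x b y∈b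
    ... | y∈ , y≢x = inj₁ y∈ , y≢x
    closeTms-fv k x (b ∷ bs) (inj₂ y∈bs) with closeTms-fv k x bs y∈bs
    ... | y∈ , y≢x = inj₂ y∈ , y≢x

  closeTy-fv : ∀ {y} k x A → FvTy y (closeTy k x A) → FvTy y A × y ≢ x
  closeTy-fv k x (atom P as) y∈A = closeTms-fv k x as y∈A
  closeTy-fv k x (A ⇒ B) (inj₁ y∈A) with closeTy-fv k x A y∈A
  ... | y∈ , y≢x = inj₁ y∈ , y≢x
  closeTy-fv k x (A ⇒ B) (inj₂ y∈B) with closeTy-fv k x B y∈B
  ... | y∈ , y≢x = inj₂ y∈ , y≢x
  closeTy-fv k x (all s A) y∈A = closeTy-fv (suc k) x A y∈A

  closeS-fv : ∀ {y} k x t → FvS y (closeS k x t) → FvS y t × y ≢ x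
  closeS-fv k x (v A) y∈t = closeTy-fv k x A y∈t
  closeS-fv k x (lam A t) (inj₁ y∈A) with closeTy-fv k x A y∈A
  ... | y∈ , y≢x = inj₁ y∈ , y≢x
  closeS-fv k x (lam A t) (inj₂ y∈t) with closeS-fv k x t y∈t
  ... | y∈ , y≢x = inj₂ y∈ , y≢x
  closeS-fv k x (t · u) (inj₁ y∈t) with closeS-fv k x t y∈t
  ... | y∈ , y≢x = inj₁ y∈ , y≢x
  closeS-fv k x (t · u) (inj₂ y∈u) with closeS-fv k x u y∈u
  ... | y∈ , y≢x = inj₂ y∈ , y≢x
  closeS-fv k x (Lam s t) y∈t = closeS-fv (suc k) x t y∈t
  closeS-fv k x (t ·ₜ b) (inj₁ y∈t) with closeS-fv k x t y∈t
  ... | y∈ , y≢x = inj₁ y∈ , y≢x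
  closeS-fv k x (t ·ₜ b) (inj₂ y∈b) with closeTm-fv k x b y∈b
  ... | y∈ , y≢x = inj₂ y∈ , y≢x

  mutual
    openTm-closeTm : ∀ {k} x b → LcTm k b → openTm k (fvar x) (closeTm k x b) ≡ b
    openTm-closeTm {k} x (fvar z) _ with x ≟V z
    ... | yes x≡z = trans (openTm-hit k (fvar x)) (cong fvar x≡z)
    ... | no _    = refl
    openTm-closeTm x (bvar i)   l = openTm-miss (fvar x) (<⇒≢ l)
    openTm-closeTm x (fun f as) l = cong (fun f) (openTms-closeTms x as l)

    openTms-closeTms : ∀ {k} x bs → LcTms k bs → openTms k (fvar x) (closeTms k x bs) ≡ bs
    openTms-closeTms x []       _        = refl
    openTms-closeTms x (b ∷ bs) (l , ls) = cong₂ _∷_ (openTm-closeTm x b l) (openTms-closeTms x bs ls)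

  openTy-closeTy : ∀ {k} x A → LcTy k A → openTy k (fvar x) (closeTy k x A) ≡ A
  openTy-closeTy x (atom P as) l        = cong (atom P) (openTms-closeTms x as l)
  openTy-closeTy x (A ⇒ B)     (l , l′) = cong₂ _⇒_ (openTy-closeTy x A l) (openTy-closeTy x B l′)
  openTy-closeTy x (all s A)   l        = cong (all s) (openTy-closeTy x A l)

  openS-closeS : ∀ {k} x t → LcS k t → openS k (fvar x) (closeS k x t) ≡ t
  openS-closeS x (v A)     l        = cong v (openTy-closeTy x A l)
  openS-closeS x (lam A t) (l , l′) = cong₂ lam (openTy-closeTy x A l) (openS-closeS x t l′)
  openS-closeS x (t · u)   (l , l′) = cong₂ _·_ (openS-closeS x t l) (openS-closeS x u l′)
  openS-closeS x (Lam s t) l        = cong (Lam s) (openS-closeS x t l)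
  openS-closeS x (t ·ₜ b)  (l , l′) = cong₂ _·ₜ_ (openS-closeS x t l) (openTm-closeTm x b l′)

  mutual
    LcTm-openTm : ∀ {k} x b → LcTm (suc k) b → LcTm k (openTm k (fvar x) b)
    LcTm-openTm x (fvar y)       _       = tt
    LcTm-openTm {k} x (bvar i) (s≤s i≤k) with i ℕ.≟ k
    ... | yes _  = tt
    ... | no i≢k = ≤∧≢⇒< i≤k i≢k
    LcTm-openTm x (fun f as)     l       = LcTms-openTms x as l

    LcTms-openTms : ∀ {k} x bs → LcTms (suc k) bs → LcTms k (openTms k (fvar x) bs)
    LcTms-openTms x []       _        = tt
    LcTms-openTms x (b ∷ bs) (l , ls) = LcTm-openTm x b l , LcTms-openTms x bs ls

  LcTy-openTy : ∀ {k} x A → LcTy (suc k) A → LcTy k (openTy k (fvar x) A)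
  LcTy-openTy x (atom P as) l        = LcTms-openTms x as l
  LcTy-openTy x (A ⇒ B)     (l , l′) = LcTy-openTy x A l , LcTy-openTy x B l′
  LcTy-openTy x (all s A)   l        = LcTy-openTy x A l

  LcS-openS : ∀ {k} x t → LcS (suc k) t → LcS k (openS k (fvar x) t)
  LcS-openS x (v A)     l        = LcTy-openTy x A l
  LcS-openS x (lam A t) (l , l′) = LcTy-openTy x A l , LcS-openS x t l′
  LcS-openS x (t · u)   (l , l′) = LcS-openS x t l , LcS-openS x u l′
  LcS-openS x (Lam s t) l        = LcS-openS x t l
  LcS-openS x (t ·ₜ b)  (l , l′) = LcS-openS x t l , LcTm-openTm x b l′

  mutual
    LcTm-closeTm : ∀ {k} x b → LcTm k b → LcTm (suc k) (closeTm k x b)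
    LcTm-closeTm {k} x (fvar z) _ with x ≟V z
    ... | yes _ = n<1+n k
    ... | no _  = tt
    LcTm-closeTm x (bvar i)   l = m<n⇒m<1+n l
    LcTm-closeTm x (fun f as) l = LcTms-closeTms x as l

    LcTms-closeTms : ∀ {k} x bs → LcTms k bs → LcTms (suc k) (closeTms k x bs)
    LcTms-closeTms x []       _        = tt
    LcTms-closeTms x (b ∷ bs) (l , ls) = LcTm-closeTm x b l , LcTms-closeTms x bs ls

  LcTy-closeTy : ∀ {k} x A → LcTy k A → LcTy (suc k) (closeTy k x A)
  LcTy-closeTy x (atom P as) l        = LcTms-closeTms x as l
  LcTy-closeTy x (A ⇒ B)     (l , l′) = LcTy-closeTy x A l , LcTy-closeTy x B l′
  LcTy-closeTy x (all s A)   l        = LcTy-closeTy x A l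

  LcS-closeS : ∀ {k} x t → LcS k t → LcS (suc k) (closeS k x t)
  LcS-closeS x (v A)     l        = LcTy-closeTy x A l
  LcS-closeS x (lam A t) (l , l′) = LcTy-closeTy x A l , LcS-closeS x t l′
  LcS-closeS x (t · u)   (l , l′) = LcS-closeS x t l , LcS-closeS x u l′
  LcS-closeS x (Lam s t) l        = LcS-closeS x t l
  LcS-closeS x (t ·ₜ b)  (l , l′) = LcS-closeS x t l , LcTm-closeTm x b l′

  mutual
    HasSort⇒Closed : ∀ {a s} → HasSort a s → Closed a
    HasSort⇒Closed fvar    = tt
    HasSort⇒Closed (fun h) = HasSorts⇒Closed h

    HasSorts⇒Closed : ∀ {as ss} → HasSorts as ss → ∀ {k} → LcTms k as
    HasSorts⇒Closed D.[]       = tt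
    HasSorts⇒Closed (h D.∷ hs) = HasSort⇒Closed h , HasSorts⇒Closed hs

  mutual
    HasSort-substTm : ∀ {b s} x {a} → HasSort b s → HasSort a (proj₁ x) → HasSort (substTm x a b) s
    HasSort-substTm x (fvar {s} {n}) ha with (s , n) ≟V x
    ... | yes refl = ha
    ... | no _     = fvar
    HasSort-substTm x (fun hs) ha = fun (HasSorts-substTms x hs ha)

    HasSorts-substTms : ∀ {bs ss} x {a} → HasSorts bs ss → HasSort a (proj₁ x) →
                        HasSorts (substTms x a bs) ss
    HasSorts-substTms x D.[]       ha = D.[]
    HasSorts-substTms x (h D.∷ hs) ha = HasSort-substTm x h ha D.∷ HasSorts-substTms x hs ha

  mutual
    boundTm : Tm → ℕ
    boundTm (fvar (_ , n)) = n
    boundTm (bvar _)       = 0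
    boundTm (fun _ as)     = boundTms as

    boundTms : List Tm → ℕ
    boundTms []       = 0
    boundTms (b ∷ bs) = boundTm b ⊔ boundTms bs

  boundTy : Ty → ℕ
  boundTy (atom _ as) = boundTms as
  boundTy (A ⇒ B)     = boundTy A ⊔ boundTy B
  boundTy (all _ A)   = boundTy A

  boundS : Sch → ℕ
  boundS (v A)     = boundTy A
  boundS (lam A t) = boundTy A ⊔ boundS t
  boundS (t · u)   = boundS t ⊔ boundS u
  boundS (Lam _ t) = boundS t
  boundS (t ·ₜ b)  = boundS t ⊔ boundTm b

  boundCtx : Ctx → ℕ
  boundCtx []      = 0
  boundCtx (A ∷ Γ) = boundTy A ⊔ boundCtx Γ

  mutual
    FvTm⇒≤boundTm : ∀ {s n} b → FvTm (s , n) b → n ≤ boundTm b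
    FvTm⇒≤boundTm (fvar _)   refl = ≤-refl
    FvTm⇒≤boundTm (fun _ as) n∈b  = FvTms⇒≤boundTms as n∈b

    FvTms⇒≤boundTms : ∀ {s n} bs → FvTms (s , n) bs → n ≤ boundTms bs
    FvTms⇒≤boundTms (b ∷ bs) (inj₁ n∈b)  = m≤n⇒m≤n⊔o (boundTms bs) (FvTm⇒≤boundTm b n∈b)
    FvTms⇒≤boundTms (b ∷ bs) (inj₂ n∈bs) = m≤n⇒m≤o⊔n (boundTm b) (FvTms⇒≤boundTms bs n∈bs)

  FvTy⇒≤boundTy : ∀ {s n} A → FvTy (s , n) A → n ≤ boundTy A
  FvTy⇒≤boundTy (atom _ as) n∈A        = FvTms⇒≤boundTms as n∈A
  FvTy⇒≤boundTy (A ⇒ B)     (inj₁ n∈A) = m≤n⇒m≤n⊔o (boundTy B) (FvTy⇒≤boundTy A n∈A)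
  FvTy⇒≤boundTy (A ⇒ B)     (inj₂ n∈B) = m≤n⇒m≤o⊔n (boundTy A) (FvTy⇒≤boundTy B n∈B)
  FvTy⇒≤boundTy (all _ A)   n∈A        = FvTy⇒≤boundTy A n∈A

  FvS⇒≤boundS : ∀ {s n} t → FvS (s , n) t → n ≤ boundS t
  FvS⇒≤boundS (v A)     n∈A        = FvTy⇒≤boundTy A n∈A
  FvS⇒≤boundS (lam A t) (inj₁ n∈A) = m≤n⇒m≤n⊔o (boundS t) (FvTy⇒≤boundTy A n∈A)
  FvS⇒≤boundS (lam A t) (inj₂ n∈t) = m≤n⇒m≤o⊔n (boundTy A) (FvS⇒≤boundS t n∈t)
  FvS⇒≤boundS (t · u)   (inj₁ n∈t) = m≤n⇒m≤n⊔o (boundS u) (FvS⇒≤boundS t n∈t)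
  FvS⇒≤boundS (t · u)   (inj₂ n∈u) = m≤n⇒m≤o⊔n (boundS t) (FvS⇒≤boundS u n∈u)
  FvS⇒≤boundS (Lam _ t) n∈t        = FvS⇒≤boundS t n∈t
  FvS⇒≤boundS (t ·ₜ b)  (inj₁ n∈t) = m≤n⇒m≤n⊔o (boundTm b) (FvS⇒≤boundS t n∈t)
  FvS⇒≤boundS (t ·ₜ b)  (inj₂ n∈b) = m≤n⇒m≤o⊔n (boundS t) (FvTm⇒≤boundTm b n∈b)

  FvCtx⇒≤boundCtx : ∀ {s n} Γ → FvCtx (s , n) Γ → n ≤ boundCtx Γ
  FvCtx⇒≤boundCtx (A ∷ Γ) (here n∈A)  = m≤n⇒m≤n⊔o (boundCtx Γ) (FvTy⇒≤boundTy A n∈A)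
  FvCtx⇒≤boundCtx (A ∷ Γ) (there n∈Γ) = m≤n⇒m≤o⊔n (boundTy A) (FvCtx⇒≤boundCtx Γ n∈Γ)

  record Fresh (s : Sort) (Γ : Ctx) (t : Sch) (A : Ty) (n : ℕ) : Set where
    field
      index : ℕ
      ∉Γ    : ¬ FvCtx (s , index) Γ
      ∉t    : ¬ FvS (s , index) t
      ∉A    : ¬ FvTy (s , index) A
      n<    : n < index

    ≢n : ∀ {s′} → (s , index) ≢ (s′ , n)
    ≢n eq = <⇒≢ n< (sym (cong proj₂ eq))

  fresh : ∀ s Γ t A n → Fresh s Γ t A n
  fresh s Γ t A n = record
    { index = suc b
    ; ∉Γ    = λ i∈Γ → <⇒≱ bΓ< (FvCtx⇒≤boundCtx Γ i∈Γ)
    ; ∉t    = λ i∈t → <⇒≱ bt< (FvS⇒≤boundS t i∈t)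
    ; ∉A    = λ i∈A → <⇒≱ bA< (FvTy⇒≤boundTy A i∈A)
    ; n<    = m⊔n<o⇒n<o _ n (n<1+n b)
    }
    where
    b : ℕ
    b = boundCtx Γ ⊔ boundS t ⊔ boundTy A ⊔ n
    bΓ< : boundCtx Γ < suc b
    bΓ< = m⊔n<o⇒m<o _ (boundS t) (m⊔n<o⇒m<o _ (boundTy A) (m⊔n<o⇒m<o _ n (n<1+n b)))
    bt< : boundS t < suc b
    bt< = m⊔n<o⇒n<o (boundCtx Γ) _ (m⊔n<o⇒m<o _ (boundTy A) (m⊔n<o⇒m<o _ n (n<1+n b)))
    bA< : boundTy A < suc b
    bA< = m⊔n<o⇒n<o (boundCtx Γ ⊔ boundS t) _ (m⊔n<o⇒m<o _ n (n<1+n b))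

  Subst : Set
  Subst = List (Var × Tm)

  WellSorted : Subst → Set
  WellSorted = All λ p → HasSort (proj₂ p) (proj₁ (proj₁ p))

  substs : {X : Set} → (Var → Tm → X → X) → Subst → X → X
  substs f []            p = p
  substs f ((x , a) ∷ σ) p = substs f σ (f x a p)

  domBound : Subst → ℕ
  domBound []            = 0
  domBound ((x , _) ∷ σ) = proj₂ x ⊔ domBound σ

  substs-fvar : ∀ σ {s n} → domBound σ < n → substs substTm σ (fvar (s , n)) ≡ fvar (s , n)
  substs-fvar []            _  = refl
  substs-fvar ((x , a) ∷ σ) {s} {n} lt =
    trans (cong (substs substTm σ) (substTm-miss a y≢x)) (substs-fvar σ (m⊔n<o⇒n<o _ _ lt))
    where
    y≢x : (s , n) ≢ x
    y≢x y≡x = <⇒≢ (m⊔n<o⇒m<o _ _ lt) (cong proj₂ (sym y≡x))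

  substs-HasSort : ∀ {σ b s} → WellSorted σ → HasSort b s → HasSort (substs substTm σ b) s
  substs-HasSort []        hb = hb
  substs-HasSort (ha ∷ ws) hb = substs-HasSort ws (HasSort-substTm _ hb ha)

  substs-⇒ : ∀ σ A B → substs substTy σ (A ⇒ B) ≡ substs substTy σ A ⇒ substs substTy σ B
  substs-⇒ []      A B = refl
  substs-⇒ (_ ∷ σ) A B = substs-⇒ σ _ _

  substs-all : ∀ σ s A → substs substTy σ (all s A) ≡ all s (substs substTy σ A)
  substs-all []      s A = refl
  substs-all (_ ∷ σ) s A = substs-all σ s _

  substs-v : ∀ σ A → substs substS σ (v A) ≡ v (substs substTy σ A)
  substs-v []      A = refl
  substs-v (_ ∷ σ) A = substs-v σ _

  substs-lam : ∀ σ A t → substs substS σ (lam A t) ≡ lam (substs substTy σ A) (substs substS σ t)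
  substs-lam []      A t = refl
  substs-lam (_ ∷ σ) A t = substs-lam σ _ _

  substs-app : ∀ σ t u → substs substS σ (t · u) ≡ substs substS σ t · substs substS σ u
  substs-app []      t u = refl
  substs-app (_ ∷ σ) t u = substs-app σ _ _

  substs-Lam : ∀ σ s t → substs substS σ (Lam s t) ≡ Lam s (substs substS σ t)
  substs-Lam []      s t = refl
  substs-Lam (_ ∷ σ) s t = substs-Lam σ s _

  substs-inst : ∀ σ t b → substs substS σ (t ·ₜ b) ≡ substs substS σ t ·ₜ substs substTm σ b
  substs-inst []      t b = refl
  substs-inst (_ ∷ σ) t b = substs-inst σ _ _

  substs-openTy : ∀ {σ} → WellSorted σ → ∀ c A →
                  substs substTy σ (openTy 0 c A) ≡ openTy 0 (substs substTm σ c) (substs substTy σ A)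
  substs-openTy []        c A = refl
  substs-openTy {(x , a) ∷ σ} (ha ∷ ws) c A =
    trans (cong (substs substTy σ) (substTy-openTy x 0 c A (HasSort⇒Closed ha))) (substs-openTy ws _ _)

  substs-openS : ∀ {σ} → WellSorted σ → ∀ c t →
                 substs substS σ (openS 0 c t) ≡ openS 0 (substs substTm σ c) (substs substS σ t)
  substs-openS []        c t = refl
  substs-openS {(x , a) ∷ σ} (ha ∷ ws) c t =
    trans (cong (substs substS σ) (substS-openS x 0 c t (HasSort⇒Closed ha))) (substs-openS ws _ _)

  SubstS : Ty → Sch → Ctx → Sch → Sch → Set
  SubstS = D.SubstS Sg

  SubstS-LcS : ∀ {A u Γ t t′} → SubstS A u Γ t t′ → LcS 0 t → LcS 0 u → LcS 0 t′
  SubstS-LcS v-rep        _            lc-u = lc-u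
  SubstS-LcS (v-keep _)   lc-t         _    = lc-t
  SubstS-LcS (v-other _)  lc-t         _    = lc-t
  SubstS-LcS (lam S)      (lc-A , lc-t) lc-u = lc-A , SubstS-LcS S lc-t lc-u
  SubstS-LcS (app S T)    (lc-t , lc-w) lc-u = SubstS-LcS S lc-t lc-u , SubstS-LcS T lc-w lc-u
  SubstS-LcS (Lam {s = s} {t = t} {t′ = t′} n _ _ _ _ S) lc-t lc-u =
    LcS-closeS (s , n) t′ (SubstS-LcS S (LcS-openS (s , n) t lc-t) lc-u)
  SubstS-LcS (inst S)     (lc-t , lc-b) lc-u = SubstS-LcS S lc-t lc-u , lc-b

  module _ {_≈_ : Ty → Ty → Set} (nc : NonConfusingCongruence Sg _≈_) where
    open NonConfusingCongruence nc

    Typed : Ctx → Sch → Ty → Set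
    Typed = D.Typed Sg _≈_

    Step : Ctx → Sch → Sch → Set
    Step = D.Step Sg

    all-≈-sort : ∀ {s s′ A B} → all s A ≈ all s′ B → s ≡ s′
    all-≈-sort ∀A≈∀B with shape ∀A≈∀B
    ... | inj₁ (_ , _ , ())
    ... | inj₂ (inj₁ (_ , _ , ()))
    ... | inj₂ (inj₂ (inj₁ (_ , _ , _ , _ , () , _)))
    ... | inj₂ (inj₂ (inj₂ (_ , _ , _ , refl , refl))) = refl

    all-≈-open : ∀ {s A B c} → all s A ≈ all s B → HasSort c s → openTy 0 c A ≈ openTy 0 c B
    all-≈-open {s} {A} {B} {c} ∀A≈∀B hc =
      subst₂ _≈_ (substTy-openTy-fresh x A x∉A lc-c) (substTy-openTy-fresh x B x∉B lc-c)
        (subst-stable x c hc (all-inj ∀A≈∀B m x∉A x∉B))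
      where
      m : ℕ
      m = suc (boundTy A ⊔ boundTy B)
      x : Var
      x = (s , m)
      lc-c : Closed c
      lc-c = HasSort⇒Closed hc
      x∉A : ¬ FvTy x A
      x∉A m∈A = <⇒≱ (m⊔n<o⇒m<o _ _ (n<1+n _)) (FvTy⇒≤boundTy A m∈A)
      x∉B : ¬ FvTy x B
      x∉B m∈B = <⇒≱ (m⊔n<o⇒n<o _ _ (n<1+n _)) (FvTy⇒≤boundTy B m∈B)

    substs-≈ : ∀ {σ A B} → WellSorted σ → A ≈ B → substs substTy σ A ≈ substs substTy σ B
    substs-≈ []                      A≈B = A≈B
    substs-≈ {(x , a) ∷ _} (ha ∷ ws) A≈B = substs-≈ ws (subst-stable x a ha A≈B)

    -- Quantifying over all substitution lists makes the ∀i case structural: its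
    -- eigenvariable is renamed to a fresh one by one more entry in front of σ.
    Typed-substs : ∀ {σ Γ Δ t A} → WellSorted σ → (∀ {B} → B ∈ Γ → substs substTy σ B ∈ Δ) →
                   Typed Γ t A → Typed Δ (substs substS σ t) (substs substTy σ A)
    Typed-substs {σ} {Δ = Δ} ws Γ↦Δ (ax {A} A∈Γ) =
      subst (λ r → Typed Δ r (substs substTy σ A)) (sym (substs-v σ A)) (ax (Γ↦Δ A∈Γ))
    Typed-substs {σ} {Δ = Δ} ws Γ↦Δ (⇒i {A} {B} {t} d) =
      subst₂ (Typed Δ) (sym (substs-lam σ A t)) (sym (substs-⇒ σ A B))
        (⇒i (Typed-substs ws (λ { (here refl) → here refl ; (there C∈Γ) → there (Γ↦Δ C∈Γ) }) d))
    Typed-substs {σ} {Δ = Δ} ws Γ↦Δ (⇒e {A} {B} {t} {u} d e) =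
      subst (λ r → Typed Δ r (substs substTy σ B)) (sym (substs-app σ t u))
        (⇒e (subst (Typed Δ _) (substs-⇒ σ A B) (Typed-substs ws Γ↦Δ d)) (Typed-substs ws Γ↦Δ e))
    Typed-substs {σ} {Γ} {Δ} ws Γ↦Δ (∀i {s} {t} {A} n x∉Γ x∉t x∉A d) =
      subst₂ (Typed Δ) (sym (substs-Lam σ s t)) (sym (substs-all σ s A))
        (∀i index ∉Γ ∉t ∉A
          (subst₂ (Typed Δ) renamed-t renamed-A (Typed-substs (fvar ∷ ws) Γ↦Δ′ d)))
      where
      open Fresh (fresh s Δ (substs substS σ t) (substs substTy σ A) (domBound σ))
      open ≡-Reasoning
      x : Var
      x = (s , n)
      y : Tm
      y = fvar (s , index)
      σ′ : Subst
      σ′ = (x , y) ∷ σ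
      Γ↦Δ′ : ∀ {B} → B ∈ Γ → substs substTy σ′ B ∈ Δ
      Γ↦Δ′ B∈Γ =
        subst (λ C → substs substTy σ C ∈ Δ) (sym (substTy-fresh x y _ (x∉Γ ∘ lose B∈Γ))) (Γ↦Δ B∈Γ)
      renamed-t : substs substS σ′ (openS 0 (fvar x) t) ≡ openS 0 y (substs substS σ t)
      renamed-t = begin
        substs substS σ (substS x y (openS 0 (fvar x) t))
          ≡⟨ cong (substs substS σ) (substS-openS-fresh x t x∉t tt) ⟩
        substs substS σ (openS 0 y t)
          ≡⟨ substs-openS ws y t ⟩
        openS 0 (substs substTm σ y) (substs substS σ t)
          ≡⟨ cong (λ c → openS 0 c (substs substS σ t)) (substs-fvar σ n<) ⟩
        openS 0 y (substs substS σ t) ∎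
      renamed-A : substs substTy σ′ (openTy 0 (fvar x) A) ≡ openTy 0 y (substs substTy σ A)
      renamed-A = begin
        substs substTy σ (substTy x y (openTy 0 (fvar x) A))
          ≡⟨ cong (substs substTy σ) (substTy-openTy-fresh x A x∉A tt) ⟩
        substs substTy σ (openTy 0 y A)
          ≡⟨ substs-openTy ws y A ⟩
        openTy 0 (substs substTm σ y) (substs substTy σ A)
          ≡⟨ cong (λ c → openTy 0 c (substs substTy σ A)) (substs-fvar σ n<) ⟩
        openTy 0 y (substs substTy σ A) ∎
    Typed-substs {σ} {Δ = Δ} ws Γ↦Δ (∀e {s} {t} {A} {b} d hb) =
      subst₂ (Typed Δ) (sym (substs-inst σ t b)) (sym (substs-openTy ws b A))
        (∀e (subst (Typed Δ _) (substs-all σ s A) (Typed-substs ws Γ↦Δ d)) (substs-HasSort ws hb))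
    Typed-substs ws Γ↦Δ (conv d A≈B) = conv (Typed-substs ws Γ↦Δ d) (substs-≈ ws A≈B)

    Typed-weaken : ∀ {Γ Δ t A} → Γ ⊆ Δ → Typed Γ t A → Typed Δ t A
    Typed-weaken = Typed-substs []

    Typed-subst : ∀ {Γ t A x a} → HasSort a (proj₁ x) → ¬ FvCtx x Γ →
                  Typed Γ t A → Typed Γ (substS x a t) (substTy x a A)
    Typed-subst {Γ} {x = x} {a} ha x∉Γ =
      Typed-substs (ha ∷ []) λ B∈Γ →
        subst (_∈ Γ) (sym (substTy-fresh x a _ (x∉Γ ∘ lose B∈Γ))) B∈Γ

    Typed-open : ∀ {Γ s n t A c} → HasSort c s →
                 ¬ FvCtx (s , n) Γ → ¬ FvS (s , n) t → ¬ FvTy (s , n) A →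
                 Typed Γ (openS 0 (fvar (s , n)) t) (openTy 0 (fvar (s , n)) A) →
                 Typed Γ (openS 0 c t) (openTy 0 c A)
    Typed-open {Γ} {s} {n} {t} {A} {c} hc x∉Γ x∉t x∉A d =
      subst₂ (Typed Γ) (substS-openS-fresh (s , n) t x∉t lc-c)
                       (substTy-openTy-fresh (s , n) A x∉A lc-c)
        (Typed-subst hc x∉Γ d)
      where
      lc-c : Closed c
      lc-c = HasSort⇒Closed hc

    OpenTyped : Ctx → Sort → Sch → Ty → Set
    OpenTyped Γ s t E = ∀ {c} → HasSort c s → Typed Γ (openS 0 c t) (openTy 0 c E)

    OpenTyped-substTy : ∀ {Γ s t E x a} → HasSort a (proj₁ x) → ¬ FvCtx x Γ → ¬ FvS x t →
                        OpenTyped Γ s t E → OpenTyped Γ s t (substTy x a E)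
    OpenTyped-substTy {Γ} {s} {t} {E} {x} {a} ha x∉Γ x∉t body hc =
      Typed-open hc ∉Γ ∉t ∉A (subst₂ (Typed Γ) keep-t move-E (Typed-subst ha x∉Γ (body fvar)))
      where
      open Fresh (fresh s Γ t (substTy x a E) (proj₂ x))
      y : Tm
      y = fvar (s , index)
      lc-a : Closed a
      lc-a = HasSort⇒Closed ha
      keep-t : substS x a (openS 0 y t) ≡ openS 0 y t
      keep-t = trans (substS-openS x 0 y t lc-a)
                     (cong₂ (openS 0) (substTm-miss a ≢n) (substS-fresh x a t x∉t))
      move-E : substTy x a (openTy 0 y E) ≡ openTy 0 y (substTy x a E)
      move-E = trans (substTy-openTy x 0 y E lc-a)
                     (cong (λ c → openTy 0 c (substTy x a E)) (substTm-miss a ≢n))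

    ax⁻ : ∀ {Γ A B} → Typed Γ (v A) B → A ∈ Γ × A ≈ B
    ax⁻ (ax A∈Γ)     = A∈Γ , ≈-refl
    ax⁻ (conv d B≈C) = let A∈Γ , A≈B = ax⁻ d in A∈Γ , ≈-trans A≈B B≈C

    ⇒i⁻ : ∀ {Γ A t B} → Typed Γ (lam A t) B → Σ Ty λ E → Typed (A ∷ Γ) t E × (A ⇒ E) ≈ B
    ⇒i⁻ (⇒i d)       = _ , d , ≈-refl
    ⇒i⁻ (conv d B≈C) = let E , d′ , A⇒E≈B = ⇒i⁻ d in E , d′ , ≈-trans A⇒E≈B B≈C

    ⇒e⁻ : ∀ {Γ t u B} → Typed Γ (t · u) B → Σ Ty λ A → Typed Γ t (A ⇒ B) × Typed Γ u A
    ⇒e⁻ (⇒e d e)     = _ , d , e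
    ⇒e⁻ (conv d B≈C) = let A , d′ , e = ⇒e⁻ d in A , conv d′ (⇒-cong ≈-refl B≈C) , e

    ∀i⁻ : ∀ {Γ s t B} → Typed Γ (Lam s t) B → Σ Ty λ E → OpenTyped Γ s t E × all s E ≈ B
    ∀i⁻ (∀i n x∉Γ x∉t x∉A d) = _ , (λ hc → Typed-open hc x∉Γ x∉t x∉A d) , ≈-refl
    ∀i⁻ (conv d B≈C)         = let E , body , ∀E≈B = ∀i⁻ d in E , body , ≈-trans ∀E≈B B≈C

    ∀e⁻ : ∀ {Γ t a B} → Typed Γ (t ·ₜ a) B →
          Σ Sort λ s → Σ Ty λ E → Typed Γ t (all s E) × HasSort a s × openTy 0 a E ≈ B
    ∀e⁻ (∀e d ha)    = _ , _ , d , ha , ≈-refl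
    ∀e⁻ (conv d B≈C) =
      let s , E , d′ , ha , E[a]≈B = ∀e⁻ d in s , E , d′ , ha , ≈-trans E[a]≈B B≈C

    SubstS-Typed : ∀ {A u Δ t t′ B} → SubstS A u Δ t t′ → LcS 0 t → LcS 0 u →
                   Typed (A ∷ Δ) t B → Typed Δ u A → Typed Δ t′ B
    SubstS-Typed v-rep         _ _ d du = conv du (proj₂ (ax⁻ d))
    SubstS-Typed (v-keep A∈Δ)  _ _ d du = conv (ax A∈Δ) (proj₂ (ax⁻ d))
    SubstS-Typed (v-other C≢A) _ _ d du with ax⁻ d
    ... | here C≡A  , _   = ⊥-elim (C≢A C≡A)
    ... | there C∈Δ , C≈B = conv (ax C∈Δ) C≈B
    SubstS-Typed (lam S) (_ , lc-t) lc-u d du =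
      let _ , dt , C⇒E≈B = ⇒i⁻ d
      in conv (⇒i (SubstS-Typed S lc-t lc-u (Typed-weaken swap dt) (Typed-weaken (xs⊆x∷xs _ _) du)))
              C⇒E≈B
      where
      swap : ∀ {C A Δ} → C ∷ A ∷ Δ ⊆ A ∷ C ∷ Δ
      swap (here p)          = there (here p)
      swap (there (here p))  = here p
      swap (there (there p)) = there (there p)
    SubstS-Typed (app S T) (lc-t , lc-w) lc-u d du =
      let _ , dt , dw = ⇒e⁻ d
      in ⇒e (SubstS-Typed S lc-t lc-u dt du) (SubstS-Typed T lc-w lc-u dw du)
    SubstS-Typed (inst S) (lc-t , _) lc-u d du =
      let _ , _ , dt , hb , E[b]≈B = ∀e⁻ d
      in conv (∀e (SubstS-Typed S lc-t lc-u dt du) hb) E[b]≈B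
    SubstS-Typed {A} {u} {Δ} (Lam {s = s} {t = t} {t′ = t′} n x∉t x∉A _ x∉Δ S) lc-t lc-u d du
      with ∀i⁻ d
    ... | E , body , ∀E≈B =
      conv (subst₂ (Typed Δ) (substS-fresh y (fvar x) _ y∉Λ) (cong (all s) (substTy-inverse x y E ∉A))
             (Typed-subst fvar ∉Γ Λ-typed))
           ∀E≈B
      where
      -- n is fresh for everything except the body's type E; the occurrences of n
      -- in E are moved aside to k before introducing ∀ and put back afterwards.
      x : Var
      x = (s , n)
      open Fresh (fresh s Δ t′ E n) renaming (index to k)
      y : Var
      y = (s , k)
      E′ : Ty
      E′ = substTy x (fvar y) E
      x∉AΔ : ¬ FvCtx x (A ∷ Δ)
      x∉AΔ (here x∈A)  = x∉A x∈A
      x∉AΔ (there x∈Δ) = x∉Δ x∈Δ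
      lc-t′ : LcS 0 t′
      lc-t′ = SubstS-LcS S (LcS-openS x t lc-t) lc-u
      Λ-typed : Typed Δ (Lam s (closeS 0 x t′)) (all s E′)
      Λ-typed = ∀i n x∉Δ (λ x∈t′ → proj₂ (closeS-fv 0 x t′ x∈t′) refl) (substTy-removes E ≢n)
        (subst (λ r → Typed Δ r (openTy 0 (fvar x) E′)) (sym (openS-closeS x t′ lc-t′))
          (SubstS-Typed S (LcS-openS x t lc-t) lc-u (OpenTyped-substTy fvar x∉AΔ x∉t body fvar) du))
      y∉Λ : ¬ FvS y (Lam s (closeS 0 x t′))
      y∉Λ = ∉t ∘ proj₁ ∘ closeS-fv 0 x t′

    Step-Typed : ∀ {Γ t u A} → LcS 0 t → Typed Γ t A → Step Γ t u → Typed Γ u A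
    Step-Typed ((_ , lc-t) , lc-w) d (β-λ S) =
      let _ , dλ , dw = ⇒e⁻ d
          _ , dt , B⇒E≈B′⇒A = ⇒i⁻ dλ
          B≈B′ , E≈A = ⇒-inj B⇒E≈B′⇒A
      in SubstS-Typed S lc-t lc-w (conv dt E≈A) (conv dw (≈-sym B≈B′))
    Step-Typed _ d β-Λ with ∀e⁻ d
    ... | _ , _ , dΛ , ha , E[a]≈A with ∀i⁻ dΛ
    ... | _ , body , ∀E′≈∀E with all-≈-sort ∀E′≈∀E
    ... | refl = conv (body ha) (≈-trans (all-≈-open ∀E′≈∀E ha) E[a]≈A)

open D using (Ty; Ctx; Sch; LcCtx; LcS; Typed; Step)

proposition4 : (Sg : Signature) (_≈_ : Ty Sg → Ty Sg → Set) →
    NonConfusingCongruence Sg _≈_ →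
    (Γ : Ctx Sg) (t u : Sch Sg) (A : Ty Sg) →
    LcCtx Sg Γ → LcS Sg 0 t →
    Typed Sg _≈_ Γ t A → Step Sg Γ t u → Typed Sg _≈_ Γ u A
proposition4 Sg _≈_ nc Γ t u A _ = Metatheory.Step-Typed Sg nc
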